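{- Let $\Gamma$ be a two-dimensional book-embedding of a weighted outerplanar graph $G=(V,E,\omega)$ and let $e\in E$. Let $\ell$ be the segment from $(x_{\min}(e),y_{\min}(e))$ to $(x_{\min}(e),0)$ and $r$ the segment from $(x_{\max}(e),y_{\min}(e))$ to $(x_{\max}(e),0)$. Then for every edge $e'\in E$, neither $\ell$ nor $r$ contains an interior point of the rectangle $\mathcal R(e')$.
   Context: A weighted graph has a positive weight $\omega(e)$ on each edge. A $1$-page book-embedding is a linear order $\mathcal L$ of the vertices with no two edges $(u,v),(w,z)$ satisfying $u\prec w\prec v\prec z$; a distinct edge $e_2=(u_2,v_2)$ is nested into $e_1=(u_1,v_1)$ if $u_1\preceq u_2\prec v_2\preceq v_1$. A two-dimensional book-embedding $\Gamma$ of $G$ consists of a $1$-page book-embedding $\mathcal L$ and a representation $\mathcal R$ such that: (1) each vertex $v$ gets coordinates $(x(v),0)$ with $x(u)<x(v)$ whenever $u\prec_{\mathcal L} v$; (2) each edge $e=(u,v)$ with $u\prec_{\mathcal L}v$ is represented by an axis-parallel rectangle $\mathcal R(e)=[x_{\min}(e),x_{\max}(e)]\times[y_{\min}(e),y_{\max}(e)]$ with $y_{\min}(e)\ge0$, $x_{\min}(e)=x(u)$, $x_{\max}(e)=x(v)$, area equal to $\omega(e)$, and $y_{\min}(e)=\max\{y_{\max}(e'):e'\text{ nested into }e\}$ (taken as $0$ if no edge is nested into $e$).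
   Formalization: The vertex coordinates, the rectangle bounds, the edge weights $\omega(e)$ and the points tested on ℓ and r all take values in the rationals. -}

module Defs where

open import Data.Nat using (ℕ)
open import Data.Fin as Fin using (Fin)
open import Data.Rational using (ℚ; 0ℚ; _≤_; _<_; _-_; _*_)
open import Data.Product using (_×_; Σ; ∃-syntax)
open import Data.Sum using (_⊎_)
open import Data.Bool using (if_then_else_)
open import Relation.Nullary using (¬_; does)
open import Relation.Binary.PropositionalEquality using (_≡_; _≢_)
open import Function.Definitions using (Injective)

record WeightedGraph : Set where
  field
    n m      : ℕ
    src tgt  : Fin m → Fin n
    loopless : ∀ i → src i ≢ tgt i
    simple   : ∀ i j →
               ((src i ≡ src j × tgt i ≡ tgt j) ⊎ (src i ≡ tgt j × tgt i ≡ src j)) →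
               i ≡ j
    ω        : Fin m → ℚ
    ω-pos    : ∀ i → 0ℚ < ω i

module _ (G : WeightedGraph) where
  open WeightedGraph G

  -- A linear order of the vertices is given by an injective (hence bijective)
  -- position map pos : Fin n → Fin n;  u ≺ v  iff  pos u < pos v.
  module Order (pos : Fin n → Fin n) where
    _≺_ : Fin n → Fin n → Set
    u ≺ v = pos u Fin.< pos v

    _≼_ : Fin n → Fin n → Set
    u ≼ v = pos u Fin.≤ pos v

    lo : Fin m → Fin n
    lo i = if does (pos (src i) Fin.<? pos (tgt i)) then src i else tgt i

    hi : Fin m → Fin n
    hi i = if does (pos (src i) Fin.<? pos (tgt i)) then tgt i else src i

    NestedInto : Fin m → Fin m → Set
    NestedInto j i = j ≢ i × lo i ≼ lo j × lo j ≺ hi j × hi j ≼ hi i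

  record OnePageBookEmbedding : Set where
    field
      pos     : Fin n → Fin n
      pos-inj : Injective _≡_ _≡_ pos
    open Order pos public
    field
      noCross : ∀ i j → ¬ (lo i ≺ lo j × lo j ≺ hi i × hi i ≺ hi j)

  record TwoDimBookEmbedding : Set where
    field
      L : OnePageBookEmbedding
    open OnePageBookEmbedding L public
    field
      x        : Fin n → ℚ
      x-mono   : ∀ u v → u ≺ v → x u < x v
      xmin xmax ymin ymax : Fin m → ℚ
      xmin-def : ∀ i → xmin i ≡ x (lo i)
      xmax-def : ∀ i → xmax i ≡ x (hi i)
      ymin-nonneg : ∀ i → 0ℚ ≤ ymin i
      area     : ∀ i → (xmax i - xmin i) * (ymax i - ymin i) ≡ ω i
      -- ymin i = max { ymax j : j nested into i }, and 0 if there is none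
      ymin-upper : ∀ i j → NestedInto j i → ymax j ≤ ymin i
      ymin-attained : ∀ i →
        (((j : Fin m) → ¬ NestedInto j i) × ymin i ≡ 0ℚ)
        ⊎ (∃[ j ] (NestedInto j i × ymax j ≡ ymin i))

    InInterior : Fin m → ℚ → ℚ → Set
    InInterior j px py =
      (xmin j < px × px < xmax j) × (ymin j < py × py < ymax j)

    OnVSegment : ℚ → Fin m → ℚ → ℚ → Set
    OnVSegment px0 i px py = px ≡ px0 × (0ℚ ≤ py × py ≤ ymin i)

{-# OPTIONS --safe #-}
-- If a point of the segment below the left (right) side of R(e) lies inside
-- R(e′), then e′ spans the left (right) endpoint of e; since e and e′ do not
-- cross, e is nested into e′.  Hence R(e′) starts at height
-- ymin e′ ≥ ymax e > ymin e, strictly above the whole segment, a contradiction.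
-- The inequality ymax e > ymin e is where positivity of the weights enters.
module Submission where

open import Defs
open import Data.Rational using (ℚ)
open import Data.Fin using (Fin)
open import Data.Product using (_×_)
open import Relation.Nullary using (¬_)

open import Data.Product using (_,_)
open import Data.Bool using (if_then_else_)
open import Relation.Nullary using (Dec; yes; no; does; contradiction)
open import Relation.Binary using (tri<; tri≈; tri>)
open import Relation.Binary.PropositionalEquality
  using (_≡_; refl; sym; cong; subst₂; module ≡-Reasoning)
open import Data.Rational as ℚ using (0ℚ; _≤_; _<_; _+_; _-_; -_; _*_; nonNegative)
import Data.Rational.Properties as ℚ
import Data.Fin as Fin
import Data.Fin.Properties as Fin
import Data.Nat.Properties as ℕ

p≤q⇒0≤q-p : ∀ {p q} → p ≤ q → 0ℚ ≤ q - p
p≤q⇒0≤q-p {p} {q} p≤q =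
  subst₂ _≤_ (ℚ.+-inverseʳ p) refl (ℚ.+-monoˡ-≤ (- p) p≤q)

0<q-p⇒p<q : ∀ {p q} → 0ℚ < q - p → p < q
0<q-p⇒p<q {p} {q} 0<q-p = subst₂ _<_ (ℚ.+-identityˡ p) q-p+p≡q (ℚ.+-monoˡ-< p 0<q-p)
  where
  open ≡-Reasoning
  q-p+p≡q : q - p + p ≡ q
  q-p+p≡q = begin
    q - p + p     ≡⟨ ℚ.+-assoc q (- p) p ⟩
    q + (- p + p) ≡⟨ cong (q +_) (ℚ.+-inverseˡ p) ⟩
    q + 0ℚ        ≡⟨ ℚ.+-identityʳ q ⟩
    q             ∎

module _ (G : WeightedGraph) where
  open WeightedGraph G

  module OnePage (L : OnePageBookEmbedding G) where
    open OnePageBookEmbedding L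

    lo≺hi : ∀ i → lo i ≺ hi i
    lo≺hi i = oriented (pos (src i) Fin.<? pos (tgt i))
      where
      oriented : (d : Dec (pos (src i) Fin.< pos (tgt i))) →
        pos (if does d then src i else tgt i) Fin.< pos (if does d then tgt i else src i)
      oriented (yes s≺t) = s≺t
      oriented (no s⊀t) with Fin.<-cmp (pos (src i)) (pos (tgt i))
      ... | tri< s≺t _ _ = contradiction s≺t s⊀t
      ... | tri≈ _ s≡t _ = contradiction (pos-inj s≡t) (loopless i)
      ... | tri> _ _ t≺s = t≺s

    spans-lo⇒nested : ∀ {i j} → lo j ≺ lo i → lo i ≺ hi j → NestedInto i j
    spans-lo⇒nested {i} {j} loj≺loi loi≺hij =
        (λ { refl → Fin.<-irrefl refl loj≺loi })
      , ℕ.<⇒≤ loj≺loi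
      , lo≺hi i
      , ℕ.≮⇒≥ (λ hij≺hii → noCross j i (loj≺loi , loi≺hij , hij≺hii))

    spans-hi⇒nested : ∀ {i j} → lo j ≺ hi i → hi i ≺ hi j → NestedInto i j
    spans-hi⇒nested {i} {j} loj≺hii hii≺hij =
        (λ { refl → Fin.<-irrefl refl hii≺hij })
      , ℕ.≮⇒≥ (λ loi≺loj → noCross i j (loi≺loj , loj≺hii , hii≺hij))
      , lo≺hi i
      , ℕ.<⇒≤ hii≺hij

  module _ (Γ : TwoDimBookEmbedding G) where
    open TwoDimBookEmbedding Γ
    open OnePage L

    x<x⇒≺ : ∀ {u v} → x u < x v → u ≺ v
    x<x⇒≺ {u} {v} xu<xv with Fin.<-cmp (pos u) (pos v)
    ... | tri< u≺v _ _ = u≺v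
    ... | tri≈ _ u≡v _ = contradiction (cong x (pos-inj u≡v)) (ℚ.<⇒≢ xu<xv)
    ... | tri> _ _ v≺u = contradiction (x-mono v u v≺u) (ℚ.<-asym xu<xv)

    xmin<xmax : ∀ i → xmin i < xmax i
    xmin<xmax i = subst₂ _<_ (sym (xmin-def i)) (sym (xmax-def i)) (x-mono _ _ (lo≺hi i))

    ymin<ymax : ∀ i → ymin i < ymax i
    ymin<ymax i = 0<q-p⇒p<q (ℚ.*-cancelˡ-<-nonNeg width {{nonNegative 0≤width}} 0<width*height)
      where
      width : ℚ
      width = xmax i - xmin i
      0≤width : 0ℚ ≤ width
      0≤width = p≤q⇒0≤q-p (ℚ.<⇒≤ (xmin<xmax i))
      0<width*height : width * 0ℚ < width * (ymax i - ymin i)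
      0<width*height = subst₂ _<_ (sym (ℚ.*-zeroʳ width)) (sym (area i)) (ω-pos i)

    nested⇒ymin<ymin : ∀ {i j} → NestedInto j i → ymin j < ymin i
    nested⇒ymin<ymin {i} {j} j⊑i = ℚ.<-≤-trans (ymin<ymax j) (ymin-upper i j j⊑i)

    interior-above-nested : ∀ {e e′ py} → NestedInto e e′ →
      py ≤ ymin e → ¬ ymin e′ < py
    interior-above-nested e⊑e′ py≤ymin ymin′<py =
      ℚ.<-irrefl refl (ℚ.≤-<-trans py≤ymin (ℚ.<-trans (nested⇒ymin<ymin e⊑e′) ymin′<py))

    left-segment-∉-interior : ∀ e e′ px py →
      ¬ (OnVSegment (xmin e) e px py × InInterior e′ px py)
    left-segment-∉-interior e e′ _ _ ((refl , _ , py≤ymin) , (xmin′<px , px<xmax′) , (ymin′<py , _)) =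
      interior-above-nested (spans-lo⇒nested loe′≺loe loe≺hie′) py≤ymin ymin′<py
      where
      loe′≺loe : lo e′ ≺ lo e
      loe′≺loe = x<x⇒≺ (subst₂ _<_ (xmin-def e′) (xmin-def e) xmin′<px)
      loe≺hie′ : lo e ≺ hi e′
      loe≺hie′ = x<x⇒≺ (subst₂ _<_ (xmin-def e) (xmax-def e′) px<xmax′)

    right-segment-∉-interior : ∀ e e′ px py →
      ¬ (OnVSegment (xmax e) e px py × InInterior e′ px py)
    right-segment-∉-interior e e′ _ _ ((refl , _ , py≤ymin) , (xmin′<px , px<xmax′) , (ymin′<py , _)) =
      interior-above-nested (spans-hi⇒nested loe′≺hie hie≺hie′) py≤ymin ymin′<py
      where
      loe′≺hie : lo e′ ≺ hi e
      loe′≺hie = x<x⇒≺ (subst₂ _<_ (xmin-def e′) (xmax-def e) xmin′<px)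
      hie≺hie′ : hi e ≺ hi e′
      hie≺hie′ = x<x⇒≺ (subst₂ _<_ (xmax-def e) (xmax-def e′) px<xmax′)

mainTheorem10 : (G : WeightedGraph) (Γ : TwoDimBookEmbedding G) →
    let open WeightedGraph G
        open TwoDimBookEmbedding Γ
    in (e e′ : Fin m) (px py : ℚ) →
       ¬ (OnVSegment (xmin e) e px py × InInterior e′ px py)
       × ¬ (OnVSegment (xmax e) e px py × InInterior e′ px py)
mainTheorem10 G Γ e e′ px py =
  left-segment-∉-interior G Γ e e′ px py , right-segment-∉-interior G Γ e e′ px py
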